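{- $\displaystyle\lim_{n\to\infty}\frac{K_n}{2^n}=\frac16$, where $K_n$ is the number of non-colourable strings in $\{0,1\}^n$.
   Context: $\#w$ is the length, $\varepsilon$ the empty string; for $\#w\ge1$, $l(w)$ is $w$ without its last letter and $r(w)$ is $w$ without its first letter. $T^n$ is the alternating string of length $n$ starting with $0$ ($T^0=\varepsilon$, $T^n=T^{n-1}0$ for odd $n$, $T^n=T^{n-1}1$ for even $n\ge2$) and $CT^n$ its letterwise complement. $\xi$: $\xi(\varepsilon)=0$; $\xi(w)=1$ if $w=T^k$, $k\ge2$ even; $\xi(w)=-1$ if $w=CT^k$, $k\ge2$ even; otherwise $\xi(w)=\operatorname{sgn}(\xi(l(w))+\xi(r(w)))$. $\phi$: $\phi(\varepsilon)=0$; $\phi(w)=-1$ if $w=0^k$, $k$ odd; $\phi(w)=1$ if $w=1^k$, $k$ odd; otherwise $\phi(w)=\operatorname{sgn}(\phi(r(w))-\phi(l(w)))$. $\psi(w)=\xi(w)^{\#w}\phi(w)$ (with $0^0=1$); $w$ is colourable iff $\psi(w)\ne0$. $K_n=\#\{w\in\{0,1\}^n:\psi(w)=0\}$. -}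

module Defs where

open import Data.Bool using (Bool; true; false; not; if_then_else_; _∧_)
import Data.Bool as B
open import Data.Nat as ℕ using (ℕ; zero; suc)
import Data.Nat.Properties as ℕP
open import Data.Integer as ℤ using (ℤ; +_; -[1+_]; 0ℤ; 1ℤ; -1ℤ)
open import Data.List using (List; []; _∷_; _++_; map; filter; length)
open import Data.Vec using (Vec; []; _∷_; _∷ʳ_; init; tail; replicate)
open import Data.Vec.Properties using (≡-dec)
open import Relation.Nullary using (does)
open import Data.Rational as ℚ using (ℚ)

-- Strings of length n over {0,1}; the letter 0 is false, 1 is true.
Str : ℕ → Set
Str n = Vec Bool n

even? : ℕ → Bool
even? zero = true
even? (suc n) = not (even? n)

strEq : ∀ {n} → Str n → Str n → Bool
strEq u v = does (≡-dec B._≟_ u v)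

-- T^n : alternating string of length n starting with 0
T : (n : ℕ) → Str n
T zero = []
T (suc n) = T n ∷ʳ (if even? (suc n) then true else false)

CT : (n : ℕ) → Str n
CT n = Data.Vec.map not (T n)

sgn : ℤ → ℤ
sgn (+ zero) = 0ℤ
sgn (+ suc _) = 1ℤ
sgn -[1+ _ ] = -1ℤ

ge2 : ℕ → Bool
ge2 (suc (suc _)) = true
ge2 _ = false

-- ξ, by recursion on the length; l = init, r = tail
ξ : (n : ℕ) → Str n → ℤ
ξ zero w = 0ℤ
ξ (suc n) w =
  if ge2 (suc n) ∧ even? (suc n) ∧ strEq w (T (suc n)) then 1ℤ
  else if ge2 (suc n) ∧ even? (suc n) ∧ strEq w (CT (suc n)) then -1ℤ
  else sgn (ξ n (init w) ℤ.+ ξ n (tail w))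

φ : (n : ℕ) → Str n → ℤ
φ zero w = 0ℤ
φ (suc n) w =
  if not (even? (suc n)) ∧ strEq w (replicate (suc n) false) then -1ℤ
  else if not (even? (suc n)) ∧ strEq w (replicate (suc n) true) then 1ℤ
  else sgn (φ n (tail w) ℤ.- φ n (init w))

-- ψ(w) = ξ(w)^{#w} φ(w)   (ℤ._^_ has 0^0 = 1)
ψ : (n : ℕ) → Str n → ℤ
ψ n w = (ξ n w ℤ.^ n) ℤ.* φ n w

-- w is colourable iff ψ(w) ≠ 0
-- list of all strings of length n
allStr : (n : ℕ) → List (Str n)
allStr zero = [] ∷ []
allStr (suc n) = map (false ∷_) (allStr n) ++ map (true ∷_) (allStr n)

K : ℕ → ℕ
K n = length (filter (λ w → ψ n w ℤ.≟ 0ℤ) (allStr n))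

ratio : ℕ → ℚ
ratio n = ℚ._/_ (+ K n) (2 ℕ.^ n) {{ℕP.m^n≢0 2 n}}

module Submission where

-- ξ and φ can be computed by peeling off the outermost pair of letters.  For w = a u b,
-- ξ(w) is the sign σ(a) (σ(0) = 1, σ(1) = −1) when a ≠ b and u is constant or alternating,
-- and ξ(u) otherwise; φ(w) is −σ(a) on the odd constant seeds, σ(a) when #u is even, a ≠ b
-- and u is constant, and −φ(u) otherwise.  These peeled forms satisfy the defining
-- recurrences of ξ and φ: splitting u = c v d, the case of a middle v that is neither
-- constant nor alternating is the induction hypothesis, and in the other cases every value
-- involved is explicit.  Consequently a u b is non-colourable iff u is and not (a ≠ b and
-- u is constant or an odd alternating string), so K(n+2) = 4 K(n) − 2 (2 or 4), that is
-- 6 K(n+2) = 2^(n+2) + (8 or 16), and |K(n)/2^n − 1/6| ≤ 16/(6·2^n).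

open import Defs
open import Data.Bool using (Bool; true; false; not; _∧_; _∨_; _xor_; if_then_else_)
import Data.Bool.Properties as Boolₚ
open import Data.Empty using (⊥-elim)
open import Data.Integer as ℤ using (ℤ; +_; -[1+_]; +<+; 0ℤ; 1ℤ; -1ℤ; -_)
import Data.Integer.Properties as ℤₚ
open import Data.List using ([]; _∷_; _++_; map; filter; length)
open import Data.List.Properties using (map-++; map-∘)
open import Data.Nat as ℕ using (ℕ; zero; suc; _+_; _*_; _^_; _≤_; z≤n; s≤s; NonZero; _≡ᵇ_)
import Data.Nat.Properties as ℕₚ
open import Algebra.Properties.CommutativeSemigroup ℕₚ.+-commutativeSemigroup using () renaming (interchange to +-interchange)
open import Data.Nat.Coprimality using (Coprime)
open import Data.Nat.ListAction using (sum)
open import Data.Nat.ListAction.Properties using (sum-++)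
open import Data.Nat.Tactic.RingSolver using (solve-∀)
open import Data.Product using (∃-syntax; _,_)
open import Data.Rational as ℚ using (ℚ; mkℚ; 0ℚ; ∣_∣; _-_; _<_; _/_; toℚᵘ; *<*)
import Data.Rational.Properties as ℚₚ
import Data.Rational.Unnormalised as ℚᵘ
import Data.Rational.Unnormalised.Properties as ℚᵘₚ
open import Data.Vec using ([]; _∷_; _∷ʳ_; init; last; tail; replicate; initLast)
open import Data.Vec.Properties using (init-∷ʳ; last-∷ʳ; ≡-dec)
open import Function using (_∘_)
open import Relation.Binary.PropositionalEquality
open import Relation.Nullary using (Dec; yes; no; does; map′; _×-dec_; _→-dec_; from-yes)
open import Relation.Unary using (Decidable)

∀-Bool? : {P : Bool → Set} → (∀ x → Dec (P x)) → Dec (∀ x → P x)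
∀-Bool? P? = map′ (λ (f , t) → λ { false → f ; true → t }) (λ h → h false , h true) (P? false ×-dec P? true)

∀-Str? : ∀ n {P : Str n → Set} → (∀ w → Dec (P w)) → Dec (∀ w → P w)
∀-Str? zero    P? = map′ (λ p → λ { [] → p }) (λ h → h []) (P? [])
∀-Str? (suc n) P? = map′ (λ h → λ { (x ∷ w) → h x w }) (λ h x w → h (x ∷ w)) (∀-Bool? λ x → ∀-Str? n (P? ∘ (x ∷_)))

_==_ : Bool → Bool → Bool
false == false = true
true  == true  = true
_     == _     = false

==-refl : ∀ x → (x == x) ≡ true
==-refl false = refl
==-refl true  = refl

==⇒≡ : ∀ {x y} → (x == y) ≡ true → x ≡ y
==⇒≡ {false} {false} _ = refl
==⇒≡ {true}  {true}  _ = refl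

σ : Bool → ℤ
σ false = 1ℤ
σ true  = -1ℤ

even?-+2 : ∀ n → even? (suc (suc n)) ≡ even? n
even?-+2 n = Boolₚ.not-involutive (even? n)

∧-∨≡false : ∀ e p q → e ∧ p ≡ false → e ∧ q ≡ false → e ∧ (p ∨ q) ≡ false
∧-∨≡false false p     q     _ _ = refl
∧-∨≡false true  false false _ _ = refl

sgn-neg : ∀ z → sgn (- z) ≡ - sgn z
sgn-neg (+ zero)  = refl
sgn-neg (+ suc n) = refl
sgn-neg -[1+ n ]  = refl

-- Constant and alternating strings

alternating : Bool → (n : ℕ) → Str n
alternating x zero    = []
alternating x (suc n) = x ∷ alternating (not x) n

letter : Bool → ℕ → Bool
letter x n = if even? n then x else not x

letter-not : ∀ x n → letter (not x) n ≡ letter x (suc n)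
letter-not x n with even? n
... | true  = refl
... | false = Boolₚ.not-involutive x

replicate-∷ʳ : ∀ n (x : Bool) → replicate (suc n) x ≡ replicate n x ∷ʳ x
replicate-∷ʳ zero    x = refl
replicate-∷ʳ (suc n) x = cong (x ∷_) (replicate-∷ʳ n x)

alternating-∷ʳ : ∀ n x → alternating x (suc n) ≡ alternating x n ∷ʳ letter x n
alternating-∷ʳ zero    x = refl
alternating-∷ʳ (suc n) x =
  cong (x ∷_) (trans (alternating-∷ʳ n (not x)) (cong (alternating (not x) n ∷ʳ_) (letter-not x n)))

T≡alternating : ∀ n → T n ≡ alternating false n
T≡alternating zero    = refl
T≡alternating (suc n) rewrite T≡alternating n | alternating-∷ʳ n false with even? n
... | true  = refl
... | false = refl

map-not-alternating : ∀ n x → Data.Vec.map not (alternating x n) ≡ alternating (not x) n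
map-not-alternating zero    x = refl
map-not-alternating (suc n) x = cong (not x ∷_) (map-not-alternating n (not x))

CT≡alternating : ∀ n → CT n ≡ alternating true n
CT≡alternating n rewrite T≡alternating n = map-not-alternating n false

isConstOf : ∀ {n} → Bool → Str n → Bool
isConstOf x []      = true
isConstOf x (y ∷ w) = (x == y) ∧ isConstOf x w

isAltFrom : ∀ {n} → Bool → Str n → Bool
isAltFrom x []      = true
isAltFrom x (y ∷ w) = (x == y) ∧ isAltFrom (not x) w

isConst : ∀ {n} → Str n → Bool
isConst w = isConstOf false w ∨ isConstOf true w

isAlt : ∀ {n} → Str n → Bool
isAlt w = isAltFrom false w ∨ isAltFrom true w

isConstOrAlt : ∀ {n} → Str n → Bool
isConstOrAlt w = isConst w ∨ isAlt w

isConstOf-∷ʳ : ∀ {n} x (u : Str n) y → isConstOf x (u ∷ʳ y) ≡ isConstOf x u ∧ (x == y)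
isConstOf-∷ʳ x []      y = Boolₚ.∧-identityʳ _
isConstOf-∷ʳ x (z ∷ u) y = trans (cong ((x == z) ∧_) (isConstOf-∷ʳ x u y)) (sym (Boolₚ.∧-assoc (x == z) _ _))

isAltFrom-∷ʳ : ∀ {n} x (u : Str n) y → isAltFrom x (u ∷ʳ y) ≡ isAltFrom x u ∧ (letter x n == y)
isAltFrom-∷ʳ x []      y = Boolₚ.∧-identityʳ _
isAltFrom-∷ʳ {suc n} x (z ∷ u) y = trans
  (cong ((x == z) ∧_) (trans (isAltFrom-∷ʳ (not x) u y) (cong (λ l → isAltFrom (not x) u ∧ (l == y)) (letter-not x n))))
  (sym (Boolₚ.∧-assoc (x == z) _ _))

isConstOf-replicate : ∀ n x → isConstOf x (replicate n x) ≡ true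
isConstOf-replicate zero    x = refl
isConstOf-replicate (suc n) x rewrite ==-refl x = isConstOf-replicate n x

isAltFrom-alternating : ∀ n x → isAltFrom x (alternating x n) ≡ true
isAltFrom-alternating zero    x = refl
isAltFrom-alternating (suc n) x rewrite ==-refl x = isAltFrom-alternating n (not x)

isConstOf⇒replicate : ∀ {n} x (w : Str n) → isConstOf x w ≡ true → w ≡ replicate n x
isConstOf⇒replicate x []      _ = refl
isConstOf⇒replicate x (y ∷ w) h with x == y in x≡y
... | true = cong₂ _∷_ (sym (==⇒≡ x≡y)) (isConstOf⇒replicate x w h)

isAltFrom⇒alternating : ∀ {n} x (w : Str n) → isAltFrom x w ≡ true → w ≡ alternating x n
isAltFrom⇒alternating x []      _ = refl
isAltFrom⇒alternating x (y ∷ w) h with x == y in x≡y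
... | true = cong₂ _∷_ (sym (==⇒≡ x≡y)) (isAltFrom⇒alternating (not x) w h)

isConstOf-replicate-suc : ∀ n y x → isConstOf y (replicate (suc n) x) ≡ (y == x)
isConstOf-replicate-suc n false false = isConstOf-replicate n false
isConstOf-replicate-suc n false true  = refl
isConstOf-replicate-suc n true  false = refl
isConstOf-replicate-suc n true  true  = isConstOf-replicate n true

isAltFrom-alternating-suc : ∀ n y x → isAltFrom y (alternating x (suc n)) ≡ (y == x)
isAltFrom-alternating-suc n false false = isAltFrom-alternating n true
isAltFrom-alternating-suc n false true  = refl
isAltFrom-alternating-suc n true  false = refl
isAltFrom-alternating-suc n true  true  = isAltFrom-alternating n false

isAltFrom-doubled : ∀ {n} y x (w : Str n) → isAltFrom y (x ∷ x ∷ w) ≡ false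
isAltFrom-doubled false false w = refl
isAltFrom-doubled false true  w = refl
isAltFrom-doubled true  false w = refl
isAltFrom-doubled true  true  w = refl

isConstOf-flipped : ∀ {n} y x (w : Str n) → isConstOf y (x ∷ not x ∷ w) ≡ false
isConstOf-flipped false false w = refl
isConstOf-flipped false true  w = refl
isConstOf-flipped true  false w = refl
isConstOf-flipped true  true  w = refl

isConst-replicate : ∀ n x → isConst (replicate n x) ≡ true
isConst-replicate n false rewrite isConstOf-replicate n false = refl
isConst-replicate n true  rewrite isConstOf-replicate n true  = Boolₚ.∨-zeroʳ _

isConstOrAlt-replicate : ∀ n x → isConstOrAlt (replicate n x) ≡ true
isConstOrAlt-replicate n x rewrite isConst-replicate n x = refl

isAlt-alternating : ∀ n x → isAlt (alternating x n) ≡ true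
isAlt-alternating n false rewrite isAltFrom-alternating n false = refl
isAlt-alternating n true  rewrite isAltFrom-alternating n true  = Boolₚ.∨-zeroʳ _

isConstOrAlt-alternating : ∀ n x → isConstOrAlt (alternating x n) ≡ true
isConstOrAlt-alternating n x rewrite isAlt-alternating n x = Boolₚ.∨-zeroʳ _

NotConst : ∀ {n} → Str n → Set
NotConst w = ∀ y → isConstOf y w ≡ false

NotAlt : ∀ {n} → Str n → Set
NotAlt w = ∀ y → isAltFrom y w ≡ false

NotConst-∷ : ∀ {n} c (v : Str n) → NotConst v → NotConst (c ∷ v)
NotConst-∷ c v h y rewrite h y = Boolₚ.∧-zeroʳ (y == c)

NotConst-∷ʳ : ∀ {n} (v : Str n) d → NotConst v → NotConst (v ∷ʳ d)
NotConst-∷ʳ v d h y rewrite isConstOf-∷ʳ y v d | h y = refl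

NotAlt-∷ : ∀ {n} c (v : Str n) → NotAlt v → NotAlt (c ∷ v)
NotAlt-∷ c v h y rewrite h (not y) = Boolₚ.∧-zeroʳ (y == c)

NotAlt-∷ʳ : ∀ {n} (v : Str n) d → NotAlt v → NotAlt (v ∷ʳ d)
NotAlt-∷ʳ v d h y rewrite isAltFrom-∷ʳ y v d | h y = refl

NotConst⇒isConst≡false : ∀ {n} (v : Str n) → NotConst v → isConst v ≡ false
NotConst⇒isConst≡false v h rewrite h false | h true = refl

NotAlt⇒isAlt≡false : ∀ {n} (v : Str n) → NotAlt v → isAlt v ≡ false
NotAlt⇒isAlt≡false v h rewrite h false | h true = refl

NotConstOrAlt⇒isConstOrAlt≡false : ∀ {n} (v : Str n) → NotConst v → NotAlt v → isConstOrAlt v ≡ false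
NotConstOrAlt⇒isConstOrAlt≡false v hc ha rewrite NotConst⇒isConst≡false v hc | NotAlt⇒isAlt≡false v ha = refl

strEq-characterised : ∀ {n} (p : Str n → Bool) (v : Str n) → p v ≡ true → (∀ w → p w ≡ true → w ≡ v)
                      → ∀ w → strEq w v ≡ p w
strEq-characterised p v pv p⇒≡ w with ≡-dec Boolₚ._≟_ w v
... | yes refl = sym pv
... | no  w≢v  with p w in pw
...   | true  = ⊥-elim (w≢v (p⇒≡ w pw))
...   | false = refl

strEq-alternating : ∀ {n} x (w : Str n) → strEq w (alternating x n) ≡ isAltFrom x w
strEq-alternating {n} x = strEq-characterised (isAltFrom x) _ (isAltFrom-alternating n x) (isAltFrom⇒alternating x)

strEq-replicate : ∀ {n} x (w : Str n) → strEq w (replicate n x) ≡ isConstOf x w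
strEq-replicate {n} x = strEq-characterised (isConstOf x) _ (isConstOf-replicate n x) (isConstOf⇒replicate x)

data Outer {n : ℕ} : Str (suc (suc n)) → Set where
  outer : (a : Bool) (u : Str n) (b : Bool) → Outer (a ∷ (u ∷ʳ b))

outer? : ∀ {n} (w : Str (suc (suc n))) → Outer w
outer? (a ∷ w) with initLast w
... | u , b , refl = outer a u b

-- The peeled form of ξ

-- ξ′ is opaque: ξ′ (a ∷ (u ∷ʳ b)) does not reduce (init (u ∷ʳ b) is stuck), and keeping it
-- folded lets ξ′-peel act as a rewrite rule.  Short strings are evaluated under `unfolding`.
opaque
  ξ′ : (n : ℕ) → Str n → ℤ
  ξ′ zero          _       = 0ℤ
  ξ′ (suc zero)    _       = 0ℤ
  ξ′ (suc (suc n)) (a ∷ w) = if isConstOrAlt (init w) ∧ (a xor last w) then σ a else ξ′ n (init w)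

  ξ′-peel : ∀ {n} a (u : Str n) b → ξ′ _ (a ∷ (u ∷ʳ b)) ≡ (if isConstOrAlt u ∧ (a xor b) then σ a else ξ′ n u)
  ξ′-peel a u b rewrite init-∷ʳ b u | last-∷ʳ b u = refl

  ξ′-[] : ∀ w → ξ′ 0 w ≡ 0ℤ
  ξ′-[] w = refl

  ξ′-[_] : ∀ w → ξ′ 1 w ≡ 0ℤ
  ξ′-[ w ] = refl

ξ′-peel-constOrAlt : ∀ {n} a (u : Str n) b → isConstOrAlt u ≡ true → ξ′ _ (a ∷ (u ∷ʳ b)) ≡ (if a xor b then σ a else ξ′ n u)
ξ′-peel-constOrAlt a u b ca rewrite ξ′-peel a u b | ca = refl

ξ′-peel-other : ∀ {n} a (u : Str n) b → NotConst u → NotAlt u → ξ′ _ (a ∷ (u ∷ʳ b)) ≡ ξ′ n u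
ξ′-peel-other a u b hc ha rewrite ξ′-peel a u b | NotConstOrAlt⇒isConstOrAlt≡false u hc ha = refl

ξ′-replicate : ∀ n x → ξ′ n (replicate n x) ≡ 0ℤ
ξ′-replicate zero          x = ξ′-[] _
ξ′-replicate (suc zero)    x = ξ′-[ _ ]
ξ′-replicate (suc (suc n)) x
  rewrite replicate-∷ʳ n x | ξ′-peel-constOrAlt x (replicate n x) x (isConstOrAlt-replicate n x) | Boolₚ.xor-same x
  = ξ′-replicate n x

ξ′-∷-replicate : ∀ n c x → ξ′ _ (c ∷ replicate (suc n) x) ≡ (if c xor x then σ c else 0ℤ)
ξ′-∷-replicate n c x
  rewrite replicate-∷ʳ n x | ξ′-peel-constOrAlt c (replicate n x) x (isConstOrAlt-replicate n x) | ξ′-replicate n x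
  = refl

ξ′-replicate-∷ʳ : ∀ n x d → ξ′ _ (replicate (suc n) x ∷ʳ d) ≡ (if x xor d then σ x else 0ℤ)
ξ′-replicate-∷ʳ n x d
  rewrite ξ′-peel-constOrAlt x (replicate n x) d (isConstOrAlt-replicate n x) | ξ′-replicate n x
  = refl

ξ′-alternating : ∀ n x → ξ′ _ (alternating x (suc n)) ≡ (if even? (suc n) then σ x else 0ℤ)
ξ′-alternating zero          x     = ξ′-[ _ ]
ξ′-alternating (suc zero)    false = ξ′-peel-constOrAlt false [] true refl
ξ′-alternating (suc zero)    true  = ξ′-peel-constOrAlt true [] false refl
ξ′-alternating (suc (suc m)) x
  rewrite alternating-∷ʳ (suc m) (not x)
        | ξ′-peel-constOrAlt x (alternating (not x) (suc m)) (letter (not x) (suc m)) (isConstOrAlt-alternating (suc m) (not x))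
        | ξ′-alternating m (not x)
  with even? m | x
... | false | false = refl
... | false | true  = refl
... | true  | false = refl
... | true  | true  = refl

ξ′-doubled-alternating : ∀ k x → ξ′ _ (x ∷ alternating x (suc (suc k))) ≡ σ x
ξ′-doubled-alternating k x
  rewrite alternating-∷ʳ (suc k) x
        | ξ′-peel-constOrAlt x (alternating x (suc k)) (letter x (suc k)) (isConstOrAlt-alternating (suc k) x)
        | ξ′-alternating k x
  with even? (suc k) | x
... | false | false = refl
... | false | true  = refl
... | true  | false = refl
... | true  | true  = refl

ξ′-∷-alternating : ∀ k c x → ξ′ _ (c ∷ alternating x (suc (suc k)))
                   ≡ (if c xor x then (if even? (suc (suc (suc k))) then σ c else 0ℤ) else σ c)
ξ′-∷-alternating k false false = ξ′-doubled-alternating k false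
ξ′-∷-alternating k false true  = ξ′-alternating (suc (suc k)) false
ξ′-∷-alternating k true  false = ξ′-alternating (suc (suc k)) true
ξ′-∷-alternating k true  true  = ξ′-doubled-alternating k true

ξ′-alternating-∷ʳ : ∀ k x d → ξ′ _ (alternating x (suc (suc k)) ∷ʳ d)
                    ≡ (if x xor d then σ x else (if even? (suc k) then σ (not x) else 0ℤ))
ξ′-alternating-∷ʳ k x d
  rewrite ξ′-peel-constOrAlt x (alternating (not x) (suc k)) d (isConstOrAlt-alternating (suc k) (not x))
        | ξ′-alternating k (not x)
  = refl

ξ′-seed : ∀ {n} x (w : Str (suc n)) → even? (suc n) ≡ true → isAltFrom x w ≡ true → ξ′ _ w ≡ σ x
ξ′-seed {n} x w even alt rewrite isAltFrom⇒alternating x w alt | ξ′-alternating n x | even = refl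

ξ′-Recurrence : ∀ {n} → Bool → Str n → Bool → Set
ξ′-Recurrence {n} a u b = even? (suc (suc n)) ∧ isAlt (a ∷ (u ∷ʳ b)) ≡ false
                        → ξ′ _ (a ∷ (u ∷ʳ b)) ≡ sgn (ξ′ _ (a ∷ u) ℤ.+ ξ′ _ (u ∷ʳ b))

ξ′-recurrence? : ∀ {n} a (u : Str n) b → Dec (ξ′-Recurrence a u b)
ξ′-recurrence? a u b = (_ Boolₚ.≟ false) →-dec (_ ℤ.≟ _)

-- In ξ′-recurrence-const, ξ′-recurrence-alt and φ′-recurrence-const the middle v is abstract,
-- so that the facts about it can be used as rewrite rules; what remains is an identity in the
-- letters, checked case by case.
ξ′-recurrence-const : ∀ {k} a b c d x (v : Str (suc (suc k)))
  → (∀ y → isConstOf y v ≡ (y == x)) → NotAlt v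
  → ξ′ _ (c ∷ v) ≡ (if c xor x then σ c else 0ℤ)
  → ξ′ _ (v ∷ʳ d) ≡ (if x xor d then σ x else 0ℤ)
  → ξ′ _ v ≡ 0ℤ
  → ξ′-Recurrence a (c ∷ (v ∷ʳ d)) b
ξ′-recurrence-const a b c d x v hC hA h1 h2 hv _
  rewrite ξ′-peel a (c ∷ (v ∷ʳ d)) b | ξ′-peel c v d | ξ′-peel a (c ∷ v) d | ξ′-peel c (v ∷ʳ d) b | h1 | h2 | hv
        | isConstOf-∷ʳ false v d | isConstOf-∷ʳ true v d | isAltFrom-∷ʳ false v d | isAltFrom-∷ʳ true v d
        | hC false | hC true | hA false | hA true
  with x | c | d | a | b
... | false | false | false | false | false = refl
... | false | false | false | false | true  = refl
... | false | false | false | true  | false = refl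
... | false | false | false | true  | true  = refl
... | false | false | true  | false | _     = refl
... | false | false | true  | true  | _     = refl
... | false | true  | false | _     | false = refl
... | false | true  | false | _     | true  = refl
... | false | true  | true  | _     | _     = refl
... | true  | false | false | _     | _     = refl
... | true  | false | true  | _     | false = refl
... | true  | false | true  | _     | true  = refl
... | true  | true  | false | false | _     = refl
... | true  | true  | false | true  | _     = refl
... | true  | true  | true  | false | false = refl
... | true  | true  | true  | false | true  = refl
... | true  | true  | true  | true  | false = refl
... | true  | true  | true  | true  | true  = refl

ξ′-recurrence-alt : ∀ {k} a b c d x (v : Str (suc (suc k)))
  → NotConst v → (∀ y → isAltFrom y v ≡ (y == x))
  → ξ′ _ (c ∷ v) ≡ (if c xor x then (if even? (suc (suc (suc k))) then σ c else 0ℤ) else σ c)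
  → ξ′ _ (v ∷ʳ d) ≡ (if x xor d then σ x else (if even? (suc k) then σ (not x) else 0ℤ))
  → ξ′ _ v ≡ (if even? (suc (suc k)) then σ x else 0ℤ)
  → ξ′-Recurrence a (c ∷ (v ∷ʳ d)) b
ξ′-recurrence-alt {k} a b c d x v hC hA h1 h2 hv
  rewrite ξ′-peel a (c ∷ (v ∷ʳ d)) b | ξ′-peel c v d | ξ′-peel a (c ∷ v) d | ξ′-peel c (v ∷ʳ d) b | h1 | h2 | hv
        | isConstOf-∷ʳ false v d | isConstOf-∷ʳ true v d | isAltFrom-∷ʳ false (v ∷ʳ d) b | isAltFrom-∷ʳ true (v ∷ʳ d) b
        | isAltFrom-∷ʳ false v d | isAltFrom-∷ʳ true v d
        | hC false | hC true | hA false | hA true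
  with even? k | x | c | d | a | b
... | false | false | false | false | _     | _     = λ _ → refl
... | false | false | false | true  | _     | false = λ _ → refl
... | false | false | false | true  | _     | true  = λ _ → refl
... | false | false | true  | false | false | _     = λ _ → refl
... | false | false | true  | false | true  | _     = λ _ → refl
... | false | false | true  | true  | false | false = λ _ → refl
... | false | false | true  | true  | false | true  = λ _ → refl
... | false | false | true  | true  | true  | false = λ _ → refl
... | false | false | true  | true  | true  | true  = λ _ → refl
... | false | true  | false | false | false | false = λ _ → refl
... | false | true  | false | false | false | true  = λ _ → refl
... | false | true  | false | false | true  | false = λ _ → refl
... | false | true  | false | false | true  | true  = λ _ → refl
... | false | true  | false | true  | false | _     = λ _ → refl
... | false | true  | false | true  | true  | _     = λ _ → refl
... | false | true  | true  | false | _     | false = λ _ → refl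
... | false | true  | true  | false | _     | true  = λ _ → refl
... | false | true  | true  | true  | _     | _     = λ _ → refl
... | true  | false | false | false | _     | false = λ _ → refl
... | true  | false | false | false | _     | true  = λ _ → refl
... | true  | false | false | true  | _     | _     = λ _ → refl
... | true  | false | true  | false | false | false = λ _ → refl
... | true  | false | true  | false | false | true  = λ ()
... | true  | false | true  | false | true  | false = λ _ → refl
... | true  | false | true  | false | true  | true  = λ _ → refl
... | true  | false | true  | true  | false | _     = λ _ → refl
... | true  | false | true  | true  | true  | _     = λ _ → refl
... | true  | true  | false | false | false | _     = λ _ → refl
... | true  | true  | false | false | true  | _     = λ _ → refl
... | true  | true  | false | true  | false | false = λ _ → refl
... | true  | true  | false | true  | false | true  = λ _ → refl
... | true  | true  | false | true  | true  | false = λ ()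
... | true  | true  | false | true  | true  | true  = λ _ → refl
... | true  | true  | true  | false | _     | _     = λ _ → refl
... | true  | true  | true  | true  | _     | false = λ _ → refl
... | true  | true  | true  | true  | _     | true  = λ _ → refl

ξ′-recurrence-replicate : ∀ {k} a b c d x → ξ′-Recurrence a (c ∷ (replicate (suc (suc k)) x ∷ʳ d)) b
ξ′-recurrence-replicate {k} a b c d x =
  ξ′-recurrence-const a b c d x _ (λ y → isConstOf-replicate-suc (suc k) y x) (λ y → isAltFrom-doubled y x (replicate k x))
    (ξ′-∷-replicate (suc k) c x) (ξ′-replicate-∷ʳ (suc k) x d) (ξ′-replicate _ x)

ξ′-recurrence-alternating : ∀ {k} a b c d x → ξ′-Recurrence a (c ∷ (alternating x (suc (suc k)) ∷ʳ d)) b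
ξ′-recurrence-alternating {k} a b c d x =
  ξ′-recurrence-alt a b c d x _ (λ y → isConstOf-flipped y x (alternating (not (not x)) k))
    (λ y → isAltFrom-alternating-suc (suc k) y x)
    (ξ′-∷-alternating k c x) (ξ′-alternating-∷ʳ k x d) (ξ′-alternating (suc k) x)

ξ′-recurrence-other : ∀ {k} a b c d (v : Str k) → NotConst v → NotAlt v
  → ξ′ _ (c ∷ (v ∷ʳ d)) ≡ sgn (ξ′ _ (c ∷ v) ℤ.+ ξ′ _ (v ∷ʳ d))
  → ξ′ _ (a ∷ ((c ∷ (v ∷ʳ d)) ∷ʳ b)) ≡ sgn (ξ′ _ (a ∷ (c ∷ (v ∷ʳ d))) ℤ.+ ξ′ _ ((c ∷ (v ∷ʳ d)) ∷ʳ b))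
ξ′-recurrence-other a b c d v hc ha ih = begin
  ξ′ _ (a ∷ ((c ∷ (v ∷ʳ d)) ∷ʳ b))
    ≡⟨ ξ′-peel-other a (c ∷ (v ∷ʳ d)) b (NotConst-∷ c (v ∷ʳ d) (NotConst-∷ʳ v d hc)) (NotAlt-∷ c (v ∷ʳ d) (NotAlt-∷ʳ v d ha)) ⟩
  ξ′ _ (c ∷ (v ∷ʳ d))
    ≡⟨ ih ⟩
  sgn (ξ′ _ (c ∷ v) ℤ.+ ξ′ _ (v ∷ʳ d))
    ≡⟨ sym (cong₂ (λ p q → sgn (p ℤ.+ q)) (ξ′-peel-other a (c ∷ v) d (NotConst-∷ c v hc) (NotAlt-∷ c v ha))
                                          (ξ′-peel-other c (v ∷ʳ d) b (NotConst-∷ʳ v d hc) (NotAlt-∷ʳ v d ha))) ⟩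
  sgn (ξ′ _ (a ∷ (c ∷ (v ∷ʳ d))) ℤ.+ ξ′ _ ((c ∷ (v ∷ʳ d)) ∷ʳ b)) ∎
  where open ≡-Reasoning

ξ′-recurrence-step : ∀ k → (∀ c (v : Str (suc (suc k))) d → ξ′-Recurrence c v d)
                     → ∀ a (u : Str (suc (suc (suc (suc k))))) b → ξ′-Recurrence a u b
ξ′-recurrence-step k ih a u b with outer? u
... | outer c v d with isConstOf false v in c₀ | isConstOf true v in c₁ | isAltFrom false v in a₀ | isAltFrom true v in a₁
...   | true  | _     | _     | _     = subst (λ v → ξ′-Recurrence a (c ∷ (v ∷ʳ d)) b) (sym (isConstOf⇒replicate false v c₀))
                                          (ξ′-recurrence-replicate a b c d false)
...   | false | true  | _     | _     = subst (λ v → ξ′-Recurrence a (c ∷ (v ∷ʳ d)) b) (sym (isConstOf⇒replicate true v c₁))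
                                          (ξ′-recurrence-replicate a b c d true)
...   | false | false | true  | _     = subst (λ v → ξ′-Recurrence a (c ∷ (v ∷ʳ d)) b) (sym (isAltFrom⇒alternating false v a₀))
                                          (ξ′-recurrence-alternating a b c d false)
...   | false | false | false | true  = subst (λ v → ξ′-Recurrence a (c ∷ (v ∷ʳ d)) b) (sym (isAltFrom⇒alternating true v a₁))
                                          (ξ′-recurrence-alternating a b c d true)
...   | false | false | false | false = λ _ → ξ′-recurrence-other a b c d v notConst notAlt (ih c v d notSeed)
  where
    notConst : NotConst v
    notConst false = c₀
    notConst true  = c₁
    notAlt : NotAlt v
    notAlt false = a₀
    notAlt true  = a₁
    notSeed : even? (suc (suc (suc (suc k)))) ∧ isAlt (c ∷ (v ∷ʳ d)) ≡ false
    notSeed rewrite NotAlt⇒isAlt≡false (c ∷ (v ∷ʳ d)) (NotAlt-∷ c (v ∷ʳ d) (NotAlt-∷ʳ v d notAlt)) = Boolₚ.∧-zeroʳ _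

opaque
  unfolding ξ′

  ξ′-recurrence : ∀ j a (u : Str (suc j)) b → ξ′-Recurrence a u b
  ξ′-recurrence 0 = from-yes (∀-Bool? λ a → ∀-Str? 1 λ u → ∀-Bool? λ b → ξ′-recurrence? a u b)
  ξ′-recurrence 1 = from-yes (∀-Bool? λ a → ∀-Str? 2 λ u → ∀-Bool? λ b → ξ′-recurrence? a u b)
  ξ′-recurrence 2 = from-yes (∀-Bool? λ a → ∀-Str? 3 λ u → ∀-Bool? λ b → ξ′-recurrence? a u b)
  ξ′-recurrence (suc (suc (suc k))) = ξ′-recurrence-step k (ξ′-recurrence (suc k))

ξ-unfold : ∀ n (w : Str (suc (suc n))) → ξ _ w ≡
  (if even? (suc (suc n)) ∧ isAltFrom false w then σ false
   else if even? (suc (suc n)) ∧ isAltFrom true w then σ true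
   else sgn (ξ _ (init w) ℤ.+ ξ _ (tail w)))
ξ-unfold n w = cong₂ (λ p q → if p then 1ℤ else if q then -1ℤ else sgn (ξ _ (init w) ℤ.+ ξ _ (tail w)))
  (cong (even? (suc (suc n)) ∧_) (trans (cong (strEq w) (T≡alternating _)) (strEq-alternating false w)))
  (cong (even? (suc (suc n)) ∧_) (trans (cong (strEq w) (CT≡alternating _)) (strEq-alternating true w)))

ξ≡ξ′-step : ∀ j → (∀ w → ξ (suc (suc j)) w ≡ ξ′ _ w) → ∀ w → ξ (suc (suc (suc j))) w ≡ ξ′ _ w
ξ≡ξ′-step j ih w with outer? w
... | outer a u b rewrite ξ-unfold (suc j) (a ∷ (u ∷ʳ b))
  with even? (suc (suc (suc j))) ∧ isAltFrom false (a ∷ (u ∷ʳ b)) in s₀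
...   | true = sym (ξ′-seed false _ (Boolₚ.∧-conicalˡ (even? (suc (suc (suc j)))) _ s₀) (Boolₚ.∧-conicalʳ (even? (suc (suc (suc j)))) _ s₀))
...   | false with even? (suc (suc (suc j))) ∧ isAltFrom true (a ∷ (u ∷ʳ b)) in s₁
...     | true  = sym (ξ′-seed true _ (Boolₚ.∧-conicalˡ (even? (suc (suc (suc j)))) _ s₁) (Boolₚ.∧-conicalʳ (even? (suc (suc (suc j)))) _ s₁))
...     | false = begin
  sgn (ξ _ (init ((a ∷ u) ∷ʳ b)) ℤ.+ ξ _ (u ∷ʳ b))  ≡⟨ cong (λ p → sgn (ξ _ p ℤ.+ ξ _ (u ∷ʳ b))) (init-∷ʳ b (a ∷ u)) ⟩
  sgn (ξ _ (a ∷ u) ℤ.+ ξ _ (u ∷ʳ b))                  ≡⟨ cong₂ (λ p q → sgn (p ℤ.+ q)) (ih (a ∷ u)) (ih (u ∷ʳ b)) ⟩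
  sgn (ξ′ _ (a ∷ u) ℤ.+ ξ′ _ (u ∷ʳ b))                ≡⟨ sym (ξ′-recurrence j a u b (∧-∨≡false e (isAltFrom false (a ∷ (u ∷ʳ b))) _ s₀ s₁)) ⟩
  ξ′ _ (a ∷ (u ∷ʳ b))                               ∎
  where
    open ≡-Reasoning
    e = even? (suc (suc (suc j)))

opaque
  unfolding ξ′

  ξ≡ξ′ : ∀ n w → ξ n w ≡ ξ′ n w
  ξ≡ξ′ 0 = from-yes (∀-Str? 0 λ w → ξ 0 w ℤ.≟ ξ′ 0 w)
  ξ≡ξ′ 1 = from-yes (∀-Str? 1 λ w → ξ 1 w ℤ.≟ ξ′ 1 w)
  ξ≡ξ′ 2 = from-yes (∀-Str? 2 λ w → ξ 2 w ℤ.≟ ξ′ 2 w)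
  ξ≡ξ′ (suc (suc (suc j))) = ξ≡ξ′-step j (ξ≡ξ′ (suc (suc j)))

-- The peeled form of φ

opaque
  φ′ : (n : ℕ) → Str n → ℤ
  φ′ zero          _        = 0ℤ
  φ′ (suc zero)    (x ∷ []) = - σ x
  φ′ (suc (suc n)) (a ∷ w)  =
    if not (even? n) ∧ isConstOf a (init w) ∧ (a == last w) then - σ a
    else if even? n ∧ isConst (init w) ∧ (a xor last w) then σ a
    else - φ′ n (init w)

  φ′-peel : ∀ {n} a (u : Str n) b → φ′ _ (a ∷ (u ∷ʳ b)) ≡
    (if not (even? n) ∧ isConstOf a u ∧ (a == b) then - σ a
     else if even? n ∧ isConst u ∧ (a xor b) then σ a
     else - φ′ n u)
  φ′-peel a u b rewrite init-∷ʳ b u | last-∷ʳ b u = refl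

  φ′-[] : ∀ w → φ′ 0 w ≡ 0ℤ
  φ′-[] w = refl

  φ′-[_] : ∀ x → φ′ 1 (x ∷ []) ≡ - σ x
  φ′-[ x ] = refl

φ′-peel-other : ∀ {n} a (u : Str n) b → NotConst u → φ′ _ (a ∷ (u ∷ʳ b)) ≡ - φ′ n u
φ′-peel-other {n} a u b h rewrite φ′-peel a u b | h a | NotConst⇒isConst≡false u h
  | Boolₚ.∧-zeroʳ (not (even? n)) | Boolₚ.∧-zeroʳ (even? n) = refl

φ′-replicate : ∀ n x → φ′ n (replicate n x) ≡ (if even? n then 0ℤ else - σ x)
φ′-replicate zero          x = φ′-[] _
φ′-replicate (suc zero)    x = φ′-[ x ]
φ′-replicate (suc (suc m)) x
  rewrite replicate-∷ʳ m x | φ′-peel x (replicate m x) x | isConstOf-replicate m x | isConst-replicate m x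
        | ==-refl x | Boolₚ.xor-same x | φ′-replicate m x
  with even? m | x
... | false | false = refl
... | false | true  = refl
... | true  | false = refl
... | true  | true  = refl

φ′-∷-replicate : ∀ k c x → φ′ _ (c ∷ replicate (suc (suc k)) x)
  ≡ (if c xor x then (if even? (suc k) then σ c else - σ c) else (if even? (suc k) then 0ℤ else - σ c))
φ′-∷-replicate k c x
  rewrite replicate-∷ʳ (suc k) x | φ′-peel c (replicate (suc k) x) x | isConstOf-replicate-suc k c x
        | isConst-replicate (suc k) x | φ′-replicate (suc k) x
  with even? k | c | x
... | false | false | false = refl
... | false | false | true  = refl
... | false | true  | false = refl
... | false | true  | true  = refl
... | true  | false | false = refl
... | true  | false | true  = refl
... | true  | true  | false = refl
... | true  | true  | true  = refl

φ′-replicate-∷ʳ : ∀ k x d → φ′ _ (replicate (suc (suc k)) x ∷ʳ d)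
  ≡ (if x xor d then σ x else (if even? (suc k) then 0ℤ else - σ x))
φ′-replicate-∷ʳ k x d
  rewrite φ′-peel x (replicate (suc k) x) d | isConstOf-replicate (suc k) x | isConst-replicate (suc k) x
        | φ′-replicate (suc k) x
  with even? k | x | d
... | false | false | false = refl
... | false | false | true  = refl
... | false | true  | false = refl
... | false | true  | true  = refl
... | true  | false | false = refl
... | true  | false | true  = refl
... | true  | true  | false = refl
... | true  | true  | true  = refl

φ′-seed : ∀ {n} x (w : Str (suc n)) → not (even? (suc n)) ≡ true → isConstOf x w ≡ true → φ′ _ w ≡ - σ x
φ′-seed {n} x w odd const rewrite isConstOf⇒replicate x w const | φ′-replicate (suc n) x with even? (suc n)
... | false = refl

φ′-Recurrence : ∀ {n} → Bool → Str n → Bool → Set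
φ′-Recurrence {n} a u b = not (even? (suc (suc n))) ∧ isConst (a ∷ (u ∷ʳ b)) ≡ false
                        → φ′ _ (a ∷ (u ∷ʳ b)) ≡ sgn (φ′ _ (u ∷ʳ b) ℤ.- φ′ _ (a ∷ u))

φ′-recurrence? : ∀ {n} a (u : Str n) b → Dec (φ′-Recurrence a u b)
φ′-recurrence? a u b = (_ Boolₚ.≟ false) →-dec (_ ℤ.≟ _)

φ′-recurrence-const : ∀ {k} a b c d x (v : Str (suc (suc k)))
  → (∀ y → isConstOf y v ≡ (y == x))
  → φ′ _ (c ∷ v) ≡ (if c xor x then (if even? (suc k) then σ c else - σ c) else (if even? (suc k) then 0ℤ else - σ c))
  → φ′ _ (v ∷ʳ d) ≡ (if x xor d then σ x else (if even? (suc k) then 0ℤ else - σ x))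
  → φ′ _ v ≡ (if even? (suc (suc k)) then 0ℤ else - σ x)
  → φ′-Recurrence a (c ∷ (v ∷ʳ d)) b
φ′-recurrence-const {k} a b c d x v hC h1 h2 hv
  rewrite φ′-peel a (c ∷ (v ∷ʳ d)) b | φ′-peel c v d | φ′-peel a (c ∷ v) d | φ′-peel c (v ∷ʳ d) b | h1 | h2 | hv
        | isConstOf-∷ʳ false (v ∷ʳ d) b | isConstOf-∷ʳ true (v ∷ʳ d) b
        | isConstOf-∷ʳ false v d | isConstOf-∷ʳ true v d | isConstOf-∷ʳ a v d | isConstOf-∷ʳ c v d
        | hC false | hC true | hC a | hC c
  with even? k | x | c | d | a | b
... | false | false | false | false | false | false = λ ()
... | false | false | false | false | false | true  = λ _ → refl
... | false | false | false | false | true  | false = λ _ → refl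
... | false | false | false | false | true  | true  = λ _ → refl
... | false | false | false | true  | false | _     = λ _ → refl
... | false | false | false | true  | true  | _     = λ _ → refl
... | false | false | true  | false | false | false = λ _ → refl
... | false | false | true  | false | false | true  = λ _ → refl
... | false | false | true  | false | true  | false = λ _ → refl
... | false | false | true  | false | true  | true  = λ _ → refl
... | false | false | true  | true  | false | _     = λ _ → refl
... | false | false | true  | true  | true  | _     = λ _ → refl
... | false | true  | false | false | false | _     = λ _ → refl
... | false | true  | false | false | true  | _     = λ _ → refl
... | false | true  | false | true  | false | false = λ _ → refl
... | false | true  | false | true  | false | true  = λ _ → refl
... | false | true  | false | true  | true  | false = λ _ → refl
... | false | true  | false | true  | true  | true  = λ _ → refl
... | false | true  | true  | false | false | _     = λ _ → refl
... | false | true  | true  | false | true  | _     = λ _ → refl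
... | false | true  | true  | true  | false | false = λ _ → refl
... | false | true  | true  | true  | false | true  = λ _ → refl
... | false | true  | true  | true  | true  | false = λ _ → refl
... | false | true  | true  | true  | true  | true  = λ ()
... | true  | false | false | false | false | false = λ _ → refl
... | true  | false | false | false | false | true  = λ _ → refl
... | true  | false | false | false | true  | false = λ _ → refl
... | true  | false | false | false | true  | true  = λ _ → refl
... | true  | false | false | true  | false | _     = λ _ → refl
... | true  | false | false | true  | true  | _     = λ _ → refl
... | true  | false | true  | false | false | _     = λ _ → refl
... | true  | false | true  | false | true  | _     = λ _ → refl
... | true  | false | true  | true  | false | _     = λ _ → refl
... | true  | false | true  | true  | true  | _     = λ _ → refl
... | true  | true  | false | false | false | _     = λ _ → refl
... | true  | true  | false | false | true  | _     = λ _ → refl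
... | true  | true  | false | true  | false | _     = λ _ → refl
... | true  | true  | false | true  | true  | _     = λ _ → refl
... | true  | true  | true  | false | false | _     = λ _ → refl
... | true  | true  | true  | false | true  | _     = λ _ → refl
... | true  | true  | true  | true  | false | false = λ _ → refl
... | true  | true  | true  | true  | false | true  = λ _ → refl
... | true  | true  | true  | true  | true  | false = λ _ → refl
... | true  | true  | true  | true  | true  | true  = λ _ → refl

φ′-recurrence-replicate : ∀ {k} a b c d x → φ′-Recurrence a (c ∷ (replicate (suc (suc k)) x ∷ʳ d)) b
φ′-recurrence-replicate {k} a b c d x =
  φ′-recurrence-const a b c d x _ (λ y → isConstOf-replicate-suc (suc k) y x)
    (φ′-∷-replicate k c x) (φ′-replicate-∷ʳ k x d) (φ′-replicate _ x)

φ′-recurrence-other : ∀ {k} a b c d (v : Str k) → NotConst v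
  → φ′ _ (c ∷ (v ∷ʳ d)) ≡ sgn (φ′ _ (v ∷ʳ d) ℤ.- φ′ _ (c ∷ v))
  → φ′ _ (a ∷ ((c ∷ (v ∷ʳ d)) ∷ʳ b)) ≡ sgn (φ′ _ ((c ∷ (v ∷ʳ d)) ∷ʳ b) ℤ.- φ′ _ (a ∷ (c ∷ (v ∷ʳ d))))
φ′-recurrence-other a b c d v h ih = begin
  φ′ _ (a ∷ ((c ∷ (v ∷ʳ d)) ∷ʳ b))       ≡⟨ φ′-peel-other a (c ∷ (v ∷ʳ d)) b (NotConst-∷ c (v ∷ʳ d) (NotConst-∷ʳ v d h)) ⟩
  - φ′ _ (c ∷ (v ∷ʳ d))                   ≡⟨ cong -_ ih ⟩
  - sgn (φ′ _ (v ∷ʳ d) ℤ.- φ′ _ (c ∷ v))     ≡⟨ sym (sgn-neg _) ⟩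
  sgn (- (φ′ _ (v ∷ʳ d) ℤ.- φ′ _ (c ∷ v)))   ≡⟨ cong sgn (ℤₚ.neg-distrib-+ (φ′ _ (v ∷ʳ d)) (- φ′ _ (c ∷ v))) ⟩
  sgn (- φ′ _ (v ∷ʳ d) ℤ.- - φ′ _ (c ∷ v))   ≡⟨ sym (cong₂ (λ p q → sgn (p ℤ.- q)) (φ′-peel-other c (v ∷ʳ d) b (NotConst-∷ʳ v d h))
                                                                           (φ′-peel-other a (c ∷ v) d (NotConst-∷ c v h))) ⟩
  sgn (φ′ _ ((c ∷ (v ∷ʳ d)) ∷ʳ b) ℤ.- φ′ _ (a ∷ (c ∷ (v ∷ʳ d)))) ∎
  where open ≡-Reasoning

φ′-recurrence-step : ∀ k → (∀ c (v : Str (suc (suc k))) d → φ′-Recurrence c v d)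
                     → ∀ a (u : Str (suc (suc (suc (suc k))))) b → φ′-Recurrence a u b
φ′-recurrence-step k ih a u b with outer? u
... | outer c v d with isConstOf false v in c₀ | isConstOf true v in c₁
...   | true  | _     = subst (λ v → φ′-Recurrence a (c ∷ (v ∷ʳ d)) b) (sym (isConstOf⇒replicate false v c₀))
                          (φ′-recurrence-replicate a b c d false)
...   | false | true  = subst (λ v → φ′-Recurrence a (c ∷ (v ∷ʳ d)) b) (sym (isConstOf⇒replicate true v c₁))
                          (φ′-recurrence-replicate a b c d true)
...   | false | false = λ _ → φ′-recurrence-other a b c d v notConst (ih c v d notSeed)
  where
    notConst : NotConst v
    notConst false = c₀
    notConst true  = c₁
    notSeed : not (even? (suc (suc (suc (suc k))))) ∧ isConst (c ∷ (v ∷ʳ d)) ≡ false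
    notSeed rewrite NotConst⇒isConst≡false (c ∷ (v ∷ʳ d)) (NotConst-∷ c (v ∷ʳ d) (NotConst-∷ʳ v d notConst)) = Boolₚ.∧-zeroʳ _

opaque
  unfolding φ′

  φ′-recurrence : ∀ j a (u : Str (suc j)) b → φ′-Recurrence a u b
  φ′-recurrence 0 = from-yes (∀-Bool? λ a → ∀-Str? 1 λ u → ∀-Bool? λ b → φ′-recurrence? a u b)
  φ′-recurrence 1 = from-yes (∀-Bool? λ a → ∀-Str? 2 λ u → ∀-Bool? λ b → φ′-recurrence? a u b)
  φ′-recurrence 2 = from-yes (∀-Bool? λ a → ∀-Str? 3 λ u → ∀-Bool? λ b → φ′-recurrence? a u b)
  φ′-recurrence (suc (suc (suc k))) = φ′-recurrence-step k (φ′-recurrence (suc k))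

φ-unfold : ∀ n (w : Str (suc (suc n))) → φ _ w ≡
  (if not (even? (suc (suc n))) ∧ isConstOf false w then - σ false
   else if not (even? (suc (suc n))) ∧ isConstOf true w then - σ true
   else sgn (φ _ (tail w) ℤ.- φ _ (init w)))
φ-unfold n w = cong₂ (λ p q → if p then -1ℤ else if q then 1ℤ else sgn (φ _ (tail w) ℤ.- φ _ (init w)))
  (cong (not (even? (suc (suc n))) ∧_) (strEq-replicate false w))
  (cong (not (even? (suc (suc n))) ∧_) (strEq-replicate true w))

φ≡φ′-step : ∀ j → (∀ w → φ (suc (suc j)) w ≡ φ′ _ w) → ∀ w → φ (suc (suc (suc j))) w ≡ φ′ _ w
φ≡φ′-step j ih w with outer? w
... | outer a u b rewrite φ-unfold (suc j) (a ∷ (u ∷ʳ b))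
  with not (even? (suc (suc (suc j)))) ∧ isConstOf false (a ∷ (u ∷ʳ b)) in s₀
...   | true = sym (φ′-seed false _ (Boolₚ.∧-conicalˡ (not (even? (suc (suc (suc j))))) _ s₀) (Boolₚ.∧-conicalʳ (not (even? (suc (suc (suc j))))) _ s₀))
...   | false with not (even? (suc (suc (suc j)))) ∧ isConstOf true (a ∷ (u ∷ʳ b)) in s₁
...     | true  = sym (φ′-seed true _ (Boolₚ.∧-conicalˡ (not (even? (suc (suc (suc j))))) _ s₁) (Boolₚ.∧-conicalʳ (not (even? (suc (suc (suc j))))) _ s₁))
...     | false = begin
  sgn (φ _ (u ∷ʳ b) ℤ.- φ _ (init ((a ∷ u) ∷ʳ b)))  ≡⟨ cong (λ p → sgn (φ _ (u ∷ʳ b) ℤ.- φ _ p)) (init-∷ʳ b (a ∷ u)) ⟩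
  sgn (φ _ (u ∷ʳ b) ℤ.- φ _ (a ∷ u))                  ≡⟨ cong₂ (λ p q → sgn (p ℤ.- q)) (ih (u ∷ʳ b)) (ih (a ∷ u)) ⟩
  sgn (φ′ _ (u ∷ʳ b) ℤ.- φ′ _ (a ∷ u))                ≡⟨ sym (φ′-recurrence j a u b (∧-∨≡false odd (isConstOf false (a ∷ (u ∷ʳ b))) _ s₀ s₁)) ⟩
  φ′ _ (a ∷ (u ∷ʳ b))                               ∎
  where
    open ≡-Reasoning
    odd = not (even? (suc (suc (suc j))))

opaque
  unfolding φ′

  φ≡φ′ : ∀ n w → φ n w ≡ φ′ n w
  φ≡φ′ 0 = from-yes (∀-Str? 0 λ w → φ 0 w ℤ.≟ φ′ 0 w)
  φ≡φ′ 1 = from-yes (∀-Str? 1 λ w → φ 1 w ℤ.≟ φ′ 1 w)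
  φ≡φ′ 2 = from-yes (∀-Str? 2 λ w → φ 2 w ℤ.≟ φ′ 2 w)
  φ≡φ′ (suc (suc (suc j))) = φ≡φ′-step j (φ≡φ′ (suc (suc j)))

-- Non-colourable strings

isZero : ℤ → Bool
isZero z = ℤ.∣ z ∣ ≡ᵇ 0

*-≡ᵇ0 : ∀ m n → (m * n ≡ᵇ 0) ≡ (m ≡ᵇ 0) ∨ (n ≡ᵇ 0)
*-≡ᵇ0 zero    n       = refl
*-≡ᵇ0 (suc m) zero    rewrite ℕₚ.*-zeroʳ m = refl
*-≡ᵇ0 (suc m) (suc n) = refl

isZero-* : ∀ x y → isZero (x ℤ.* y) ≡ isZero x ∨ isZero y
isZero-* x y = trans (cong (_≡ᵇ 0) (ℤₚ.abs-* x y)) (*-≡ᵇ0 ℤ.∣ x ∣ ℤ.∣ y ∣)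

isZero-^ : ∀ x n → isZero (x ℤ.^ suc n) ≡ isZero x
isZero-^ x zero    = trans (isZero-* x 1ℤ) (Boolₚ.∨-identityʳ _)
isZero-^ x (suc n) = trans (isZero-* x (x ℤ.^ suc n)) (trans (cong (isZero x ∨_) (isZero-^ x n)) (Boolₚ.∨-idem _))

isZero-neg : ∀ x → isZero (- x) ≡ isZero x
isZero-neg x = cong (_≡ᵇ 0) (ℤₚ.∣-i∣≡∣i∣ x)

isZero-σ : ∀ x → isZero (σ x) ≡ false
isZero-σ false = refl
isZero-σ true  = refl

isZero-ξ′-peel : ∀ {n} a (u : Str n) b → isZero (ξ′ _ (a ∷ (u ∷ʳ b))) ≡ not (isConstOrAlt u ∧ (a xor b)) ∧ isZero (ξ′ n u)
isZero-ξ′-peel a u b rewrite ξ′-peel a u b with isConstOrAlt u ∧ (a xor b)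
... | true  = isZero-σ a
... | false = refl

isZero-φ′-odd : ∀ n (w : Str n) → even? n ≡ false → isZero (φ′ n w) ≡ false
isZero-φ′-odd (suc zero) (x ∷ []) _ = trans (cong isZero φ′-[ x ]) (trans (isZero-neg (σ x)) (isZero-σ x))
isZero-φ′-odd (suc (suc n)) w odd with outer? w
... | outer a u b rewrite φ′-peel a u b | Boolₚ.not-involutive (even? n) | odd
  with isConstOf a u ∧ (a == b)
...   | true  = trans (isZero-neg (σ a)) (isZero-σ a)
...   | false = trans (isZero-neg (φ′ n u)) (isZero-φ′-odd n u odd)

isZero-φ′-peel-even : ∀ {n} a (u : Str n) b → even? n ≡ true
                      → isZero (φ′ _ (a ∷ (u ∷ʳ b))) ≡ not (isConst u ∧ (a xor b)) ∧ isZero (φ′ n u)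
isZero-φ′-peel-even {n} a u b even rewrite φ′-peel a u b | even with isConst u ∧ (a xor b)
... | true  = isZero-σ a
... | false = isZero-neg (φ′ n u)

isZero-ξ′-even-alternating : ∀ {n} (u : Str (suc n)) → even? (suc n) ≡ true → isZero (ξ′ _ u) ∧ isAlt u ≡ false
isZero-ξ′-even-alternating {n} u even with isAltFrom false u in a₀ | isAltFrom true u in a₁
... | true  | _     rewrite ξ′-seed false u even a₀ = refl
... | false | true  rewrite ξ′-seed true u even a₁ = refl
... | false | false = Boolₚ.∧-zeroʳ _

nonColourable : ∀ n → Str n → Bool
nonColourable n w = isZero (ψ n w)

nonColourable-suc : ∀ n (w : Str (suc n)) → nonColourable _ w ≡ isZero (ξ′ _ w) ∨ isZero (φ′ _ w)
nonColourable-suc n w = begin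
  isZero (ξ _ w ℤ.^ suc n ℤ.* φ _ w)      ≡⟨ isZero-* (ξ _ w ℤ.^ suc n) (φ _ w) ⟩
  isZero (ξ _ w ℤ.^ suc n) ∨ isZero (φ _ w) ≡⟨ cong (_∨ isZero (φ _ w)) (isZero-^ (ξ _ w) n) ⟩
  isZero (ξ _ w) ∨ isZero (φ _ w)         ≡⟨ cong₂ (λ x y → isZero x ∨ isZero y) (ξ≡ξ′ _ w) (φ≡φ′ _ w) ⟩
  isZero (ξ′ _ w) ∨ isZero (φ′ _ w)       ∎
  where open ≡-Reasoning

isCritical : ∀ {n} → Str n → Bool
isCritical {n} u = isConst u ∨ (not (even? n) ∧ isAlt u)

nonColourable-peel : ∀ {n} a (u : Str n) b → nonColourable _ (a ∷ (u ∷ʳ b)) ≡ nonColourable n u ∧ not (isCritical u ∧ (a xor b))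
nonColourable-peel {zero} false [] false = refl
nonColourable-peel {zero} false [] true  = refl
nonColourable-peel {zero} true  [] false = refl
nonColourable-peel {zero} true  [] true  = refl
nonColourable-peel {suc m} a u b
  rewrite nonColourable-suc (suc (suc m)) (a ∷ (u ∷ʳ b)) | nonColourable-suc m u | isZero-ξ′-peel a u b
  with even? m in parity
... | true rewrite isZero-φ′-odd _ (a ∷ (u ∷ʳ b)) (cong (not ∘ not ∘ not) parity) | isZero-φ′-odd _ u (cong not parity)
  = odd-case (isConstOrAlt u ∧ (a xor b)) (isZero (ξ′ _ u))
  where
    odd-case : ∀ p z → not p ∧ z ∨ false ≡ (z ∨ false) ∧ not p
    odd-case p z rewrite Boolₚ.∨-identityʳ (not p ∧ z) | Boolₚ.∨-identityʳ z = Boolₚ.∧-comm (not p) z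
... | false rewrite isZero-φ′-peel-even a u b (cong not parity)
  = even-case (a xor b) (isConst u) (isAlt u) (isZero (ξ′ _ u)) (isZero (φ′ _ u)) (isZero-ξ′-even-alternating u (cong not parity))
  where
    even-case : ∀ δ c a zξ zφ → zξ ∧ a ≡ false
              → not ((c ∨ a) ∧ δ) ∧ zξ ∨ not (c ∧ δ) ∧ zφ ≡ (zξ ∨ zφ) ∧ not ((c ∨ false) ∧ δ)
    even-case false false false zξ    zφ _ = sym (Boolₚ.∧-identityʳ _)
    even-case false false true  zξ    zφ _ = sym (Boolₚ.∧-identityʳ _)
    even-case false true  false zξ    zφ _ = sym (Boolₚ.∧-identityʳ _)
    even-case false true  true  zξ    zφ _ = sym (Boolₚ.∧-identityʳ _)
    even-case true  true  a     zξ    zφ _ = sym (Boolₚ.∧-zeroʳ _)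
    even-case true  false false zξ    zφ _ = sym (Boolₚ.∧-identityʳ _)
    even-case true  false true  false zφ _ = sym (Boolₚ.∧-identityʳ _)

isZero-ξ′-critical : ∀ {n} (u : Str (suc n)) → isCritical u ≡ true → isZero (ξ′ _ u) ≡ true
isZero-ξ′-critical {n} u critical
  with isConstOf false u in c₀ | isConstOf true u in c₁ | even? (suc n) in parity | isAltFrom false u in a₀ | isAltFrom true u in a₁
... | true  | _     | _     | _     | _    rewrite isConstOf⇒replicate false u c₀ | ξ′-replicate (suc n) false = refl
... | false | true  | _     | _     | _    rewrite isConstOf⇒replicate true u c₁ | ξ′-replicate (suc n) true = refl
... | false | false | false | true  | _    rewrite isAltFrom⇒alternating false u a₀ | ξ′-alternating n false | parity = refl
... | false | false | false | false | true rewrite isAltFrom⇒alternating true u a₁ | ξ′-alternating n true | parity = refl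

critical⇒nonColourable : ∀ {n} (u : Str n) → isCritical u ≡ true → nonColourable n u ≡ true
critical⇒nonColourable {zero}  [] _        = refl
critical⇒nonColourable {suc n} u  critical rewrite nonColourable-suc n u | isZero-ξ′-critical u critical = refl

-- Counting

𝟙 : Bool → ℕ
𝟙 true  = 1
𝟙 false = 0

length-filter≡sum : ∀ {A : Set} {P : A → Set} (P? : Decidable P) xs → length (filter P? xs) ≡ sum (map (𝟙 ∘ does ∘ P?) xs)
length-filter≡sum P? []       = refl
length-filter≡sum P? (x ∷ xs) with does (P? x)
... | true  = cong suc (length-filter≡sum P? xs)
... | false = length-filter≡sum P? xs

sumStr : ∀ n → (Str n → ℕ) → ℕ
sumStr zero    g = g []
sumStr (suc n) g = sumStr n (g ∘ (false ∷_)) + sumStr n (g ∘ (true ∷_))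

sum-allStr : ∀ n g → sum (map g (allStr n)) ≡ sumStr n g
sum-allStr zero    g = ℕₚ.+-identityʳ (g [])
sum-allStr (suc n) g = begin
  sum (map g (map (false ∷_) (allStr n) ++ map (true ∷_) (allStr n)))
    ≡⟨ cong sum (map-++ g (map (false ∷_) (allStr n)) _) ⟩
  sum (map g (map (false ∷_) (allStr n)) ++ map g (map (true ∷_) (allStr n)))
    ≡⟨ sum-++ (map g (map (false ∷_) (allStr n))) _ ⟩
  sum (map g (map (false ∷_) (allStr n))) + sum (map g (map (true ∷_) (allStr n)))
    ≡⟨ cong₂ (λ p q → sum p + sum q) (sym (map-∘ (allStr n))) (sym (map-∘ (allStr n))) ⟩
  sum (map (g ∘ (false ∷_)) (allStr n)) + sum (map (g ∘ (true ∷_)) (allStr n))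
    ≡⟨ cong₂ _+_ (sum-allStr n _) (sum-allStr n _) ⟩
  sumStr (suc n) g ∎
  where open ≡-Reasoning

does-≟0 : ∀ z → does (z ℤ.≟ 0ℤ) ≡ isZero z
does-≟0 (+ zero)  = refl
does-≟0 (+ suc n) = refl
does-≟0 -[1+ n ]  = refl

sumStr-cong : ∀ n {g h : Str n → ℕ} → (∀ w → g w ≡ h w) → sumStr n g ≡ sumStr n h
sumStr-cong zero    g≗h = g≗h []
sumStr-cong (suc n) g≗h = cong₂ _+_ (sumStr-cong n (g≗h ∘ (false ∷_))) (sumStr-cong n (g≗h ∘ (true ∷_)))

K≡sumStr : ∀ n → K n ≡ sumStr n (𝟙 ∘ nonColourable n)
K≡sumStr n = begin
  length (filter (λ w → ψ n w ℤ.≟ 0ℤ) (allStr n))      ≡⟨ length-filter≡sum (λ w → ψ n w ℤ.≟ 0ℤ) (allStr n) ⟩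
  sum (map (λ w → 𝟙 (does (ψ n w ℤ.≟ 0ℤ))) (allStr n))   ≡⟨ sum-allStr n _ ⟩
  sumStr n (λ w → 𝟙 (does (ψ n w ℤ.≟ 0ℤ)))               ≡⟨ sumStr-cong n (λ w → cong 𝟙 (does-≟0 (ψ n w))) ⟩
  sumStr n (𝟙 ∘ nonColourable n)                          ∎
  where open ≡-Reasoning

sumStr-+ : ∀ n (g h : Str n → ℕ) → sumStr n (λ w → g w + h w) ≡ sumStr n g + sumStr n h
sumStr-+ zero    g h = refl
sumStr-+ (suc n) g h
  rewrite sumStr-+ n (g ∘ (false ∷_)) (h ∘ (false ∷_)) | sumStr-+ n (g ∘ (true ∷_)) (h ∘ (true ∷_))
  = +-interchange (sumStr n (g ∘ (false ∷_))) (sumStr n (h ∘ (false ∷_))) (sumStr n (g ∘ (true ∷_))) (sumStr n (h ∘ (true ∷_)))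

sumStr-* : ∀ n c (g : Str n → ℕ) → sumStr n (λ w → c * g w) ≡ c * sumStr n g
sumStr-* zero    c g = refl
sumStr-* (suc n) c g
  rewrite sumStr-* n c (g ∘ (false ∷_)) | sumStr-* n c (g ∘ (true ∷_)) = sym (ℕₚ.*-distribˡ-+ c _ _)

sumStr-∷ʳ : ∀ n (g : Str (suc n) → ℕ) → sumStr (suc n) g ≡ sumStr n (λ u → g (u ∷ʳ false) + g (u ∷ʳ true))
sumStr-∷ʳ zero    g = refl
sumStr-∷ʳ (suc n) g = cong₂ _+_ (sumStr-∷ʳ n (g ∘ (false ∷_))) (sumStr-∷ʳ n (g ∘ (true ∷_)))

sumStr-zero : ∀ n → sumStr n (λ _ → 0) ≡ 0
sumStr-zero zero    = refl
sumStr-zero (suc n) = cong₂ _+_ (sumStr-zero n) (sumStr-zero n)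

sumStr-if : ∀ n e (g : Str n → ℕ) → sumStr n (λ w → if e then 0 else g w) ≡ (if e then 0 else sumStr n g)
sumStr-if n true  g = sumStr-zero n
sumStr-if n false g = refl

sumStr-isConstOf : ∀ n x → sumStr n (𝟙 ∘ isConstOf x) ≡ 1
sumStr-isConstOf zero    x     = refl
sumStr-isConstOf (suc n) false = cong₂ _+_ (sumStr-isConstOf n false) (sumStr-zero n)
sumStr-isConstOf (suc n) true  = cong₂ _+_ (sumStr-zero n) (sumStr-isConstOf n true)

sumStr-isAltFrom : ∀ n x → sumStr n (𝟙 ∘ isAltFrom x) ≡ 1
sumStr-isAltFrom zero    x     = refl
sumStr-isAltFrom (suc n) false = cong₂ _+_ (sumStr-isAltFrom n true) (sumStr-zero n)
sumStr-isAltFrom (suc n) true  = cong₂ _+_ (sumStr-zero n) (sumStr-isAltFrom n false)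

sumStr-outer : ∀ n (g : Str (suc (suc n)) → ℕ) → sumStr (suc (suc n)) g
  ≡ sumStr n (λ u → (g (false ∷ (u ∷ʳ false)) + g (false ∷ (u ∷ʳ true))) + (g (true ∷ (u ∷ʳ false)) + g (true ∷ (u ∷ʳ true))))
sumStr-outer n g = trans (cong₂ _+_ (sumStr-∷ʳ n (g ∘ (false ∷_))) (sumStr-∷ʳ n (g ∘ (true ∷_)))) (sym (sumStr-+ n _ _))

criticalCount : ℕ → ℕ
criticalCount n = sumStr n (𝟙 ∘ isCritical)

𝟙-isCritical : ∀ {k} (u : Str (suc (suc k))) → 𝟙 (isCritical u)
  ≡ 𝟙 (isConstOf false u) + 𝟙 (isConstOf true u) + (if even? k then 0 else 𝟙 (isAltFrom false u) + 𝟙 (isAltFrom true u))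
𝟙-isCritical {k} (false ∷ false ∷ r) rewrite even?-+2 k with even? k | isConstOf false r
... | false | false = refl
... | false | true  = refl
... | true  | false = refl
... | true  | true  = refl
𝟙-isCritical {k} (false ∷ true  ∷ r) rewrite even?-+2 k with even? k | isAltFrom false r
... | false | false = refl
... | false | true  = refl
... | true  | false = refl
... | true  | true  = refl
𝟙-isCritical {k} (true  ∷ false ∷ r) rewrite even?-+2 k with even? k | isAltFrom true r
... | false | false = refl
... | false | true  = refl
... | true  | false = refl
... | true  | true  = refl
𝟙-isCritical {k} (true  ∷ true  ∷ r) rewrite even?-+2 k with even? k | isConstOf true r
... | false | false = refl
... | false | true  = refl
... | true  | false = refl
... | true  | true  = refl

criticalCount-+2 : ∀ k → criticalCount (suc (suc k)) ≡ 2 + (if even? k then 0 else 2)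
criticalCount-+2 k = begin
  sumStr m (𝟙 ∘ isCritical)
    ≡⟨ sumStr-cong m 𝟙-isCritical ⟩
  sumStr m (λ u → (const₀ u + const₁ u) + (if even? k then 0 else alt₀ u + alt₁ u))
    ≡⟨ sumStr-+ m (λ u → const₀ u + const₁ u) (λ u → if even? k then 0 else alt₀ u + alt₁ u) ⟩
  sumStr m (λ u → const₀ u + const₁ u) + sumStr m (λ u → if even? k then 0 else alt₀ u + alt₁ u)
    ≡⟨ cong₂ _+_ (sumStr-+ m const₀ const₁) (sumStr-if m (even? k) (λ u → alt₀ u + alt₁ u)) ⟩
  sumStr m const₀ + sumStr m const₁ + (if even? k then 0 else sumStr m (λ u → alt₀ u + alt₁ u))
    ≡⟨ cong (_+ (if even? k then 0 else sumStr m (λ u → alt₀ u + alt₁ u))) (cong₂ _+_ (sumStr-isConstOf m false) (sumStr-isConstOf m true)) ⟩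
  2 + (if even? k then 0 else sumStr m (λ u → alt₀ u + alt₁ u))
    ≡⟨ cong (_+_ 2) (alternatingCount (even? k)) ⟩
  2 + (if even? k then 0 else 2) ∎
  where
    open ≡-Reasoning
    m = suc (suc k)
    const₀ const₁ alt₀ alt₁ : Str (suc (suc k)) → ℕ
    const₀ = 𝟙 ∘ isConstOf false
    const₁ = 𝟙 ∘ isConstOf true
    alt₀   = 𝟙 ∘ isAltFrom false
    alt₁   = 𝟙 ∘ isAltFrom true
    alternatingCount : ∀ e → (if e then 0 else sumStr m (λ u → alt₀ u + alt₁ u)) ≡ (if e then 0 else 2)
    alternatingCount true  = refl
    alternatingCount false = trans (sumStr-+ m alt₀ alt₁) (cong₂ _+_ (sumStr-isAltFrom m false) (sumStr-isAltFrom m true))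

around : ∀ {n} → (Str (suc (suc n)) → ℕ) → Str n → ℕ
around g u = (g (false ∷ (u ∷ʳ false)) + g (false ∷ (u ∷ʳ true))) + (g (true ∷ (u ∷ʳ false)) + g (true ∷ (u ∷ʳ true)))

around-nonColourable : ∀ {n} (u : Str n) → around (𝟙 ∘ nonColourable _) u + 2 * 𝟙 (isCritical u) ≡ 4 * 𝟙 (nonColourable n u)
around-nonColourable u
  rewrite nonColourable-peel false u false | nonColourable-peel false u true
        | nonColourable-peel true u false | nonColourable-peel true u true
  = count (nonColourable _ u) (isCritical u) (critical⇒nonColourable u)
  where
    count : ∀ z c → (c ≡ true → z ≡ true)
          → 𝟙 (z ∧ not (c ∧ false)) + 𝟙 (z ∧ not (c ∧ true)) + (𝟙 (z ∧ not (c ∧ true)) + 𝟙 (z ∧ not (c ∧ false))) + 2 * 𝟙 c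
            ≡ 4 * 𝟙 z
    count false false _ = refl
    count true  false _ = refl
    count true  true  _ = refl
    count false true  c⇒z with c⇒z refl
    ... | ()

K-recurrence : ∀ n → K (suc (suc n)) + 2 * criticalCount n ≡ 4 * K n
K-recurrence n = begin
  K (suc (suc n)) + 2 * criticalCount n
    ≡⟨ cong₂ _+_ (trans (K≡sumStr (suc (suc n))) (sumStr-outer n (𝟙 ∘ nonColourable _))) (sym (sumStr-* n 2 (𝟙 ∘ isCritical))) ⟩
  sumStr n (around (𝟙 ∘ nonColourable _)) + sumStr n (λ u → 2 * 𝟙 (isCritical u))
    ≡⟨ sym (sumStr-+ n _ _) ⟩
  sumStr n (λ u → around (𝟙 ∘ nonColourable _) u + 2 * 𝟙 (isCritical u))
    ≡⟨ sumStr-cong n around-nonColourable ⟩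
  sumStr n (λ u → 4 * 𝟙 (nonColourable n u))
    ≡⟨ sumStr-* n 4 (𝟙 ∘ nonColourable n) ⟩
  4 * sumStr n (𝟙 ∘ nonColourable n)
    ≡⟨ cong (4 *_) (sym (K≡sumStr n)) ⟩
  4 * K n ∎
  where open ≡-Reasoning

excess : ℕ → ℕ
excess n = if even? n then 8 else 16

closed-form-step : ∀ k₄ k₂ P X e → k₄ + 2 * X ≡ 4 * k₂ → 6 * k₂ ≡ P + e → 12 * X + e ≡ 4 * e
                   → 6 * k₄ ≡ 2 * (2 * P) + e
closed-form-step k₄ k₂ P X e recurrence hypothesis balance = ℕₚ.+-cancelʳ-≡ (12 * X) (6 * k₄) (2 * (2 * P) + e) (begin
  6 * k₄ + 12 * X             ≡⟨ factor-6 k₄ X ⟩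
  6 * (k₄ + 2 * X)            ≡⟨ cong (6 *_) recurrence ⟩
  6 * (4 * k₂)                ≡⟨ swap-6-4 k₂ ⟩
  4 * (6 * k₂)                ≡⟨ cong (4 *_) hypothesis ⟩
  4 * (P + e)                 ≡⟨ expand-4 P e ⟩
  2 * (2 * P) + 4 * e         ≡⟨ cong (_+_ (2 * (2 * P))) (sym balance) ⟩
  2 * (2 * P) + (12 * X + e)  ≡⟨ regroup P X e ⟩
  2 * (2 * P) + e + 12 * X    ∎)
  where
    open ≡-Reasoning
    factor-6 : ∀ a x → 6 * a + 12 * x ≡ 6 * (a + 2 * x)
    factor-6 = solve-∀
    swap-6-4 : ∀ b → 6 * (4 * b) ≡ 4 * (6 * b)
    swap-6-4 = solve-∀
    expand-4 : ∀ p e → 4 * (p + e) ≡ 2 * (2 * p) + 4 * e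
    expand-4 = solve-∀
    regroup : ∀ p x e → 2 * (2 * p) + (12 * x + e) ≡ 2 * (2 * p) + e + 12 * x
    regroup = solve-∀

excess-+2 : ∀ n → excess (suc (suc n)) ≡ excess n
excess-+2 n = cong (λ e → if e then 8 else 16) (even?-+2 n)

closed-form : (k : ℕ → ℕ) → 6 * k 2 ≡ 2 ^ 2 + excess 0 → 6 * k 3 ≡ 2 ^ 3 + excess 1
  → (∀ n → k (suc (suc (suc (suc n)))) + 2 * (2 + (if even? n then 0 else 2)) ≡ 4 * k (suc (suc n)))
  → ∀ n → 6 * k (suc (suc n)) ≡ 2 ^ suc (suc n) + excess n
closed-form k k₂ k₃ recurrence zero          = k₂
closed-form k k₂ k₃ recurrence (suc zero)    = k₃
closed-form k k₂ k₃ recurrence (suc (suc n)) rewrite excess-+2 n =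
  closed-form-step (k (suc (suc (suc (suc n))))) (k (suc (suc n))) (2 ^ suc (suc n)) (2 + (if even? n then 0 else 2)) (excess n)
    (recurrence n) (closed-form k k₂ k₃ recurrence n) (balance (even? n))
  where
    balance : ∀ e → 12 * (2 + (if e then 0 else 2)) + (if e then 8 else 16) ≡ 4 * (if e then 8 else 16)
    balance true  = refl
    balance false = refl

K-closed-form : ∀ n → 6 * K (suc (suc n)) ≡ 2 ^ suc (suc n) + excess n
K-closed-form = closed-form K refl refl λ n →
  subst (λ X → K (suc (suc (suc (suc n)))) + 2 * X ≡ 4 * K (suc (suc n))) (criticalCount-+2 n) (K-recurrence (suc (suc n)))

-- The limit

toℚᵘ-/ : ∀ i d → toℚᵘ (i / suc d) ℚᵘ.≃ ℚᵘ.mkℚᵘ i d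
toℚᵘ-/ i d = ℚₚ.toℚᵘ-fromℚᵘ (ℚᵘ.mkℚᵘ i d)

toℚᵘ-∣/-1/6∣ : ∀ i d → toℚᵘ ∣ i / suc d - (+ 1) / 6 ∣ ℚᵘ.≃ ℚᵘ.∣ ℚᵘ.mkℚᵘ i d ℚᵘ.+ ℚᵘ.- ℚᵘ.mkℚᵘ (+ 1) 5 ∣
toℚᵘ-∣/-1/6∣ i d = ℚᵘₚ.≃-trans (ℚₚ.toℚᵘ-homo-∣-∣ (i / suc d - (+ 1) / 6))
  (ℚᵘₚ.∣-∣-cong (ℚᵘₚ.≃-trans (ℚₚ.toℚᵘ-homo-+ (i / suc d) (ℚ.- ((+ 1) / 6)))
    (ℚᵘₚ.≃-trans (ℚᵘₚ.+-congʳ (toℚᵘ (i / suc d)) (ℚₚ.toℚᵘ-homo‿- ((+ 1) / 6)))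
      (ℚᵘₚ.+-congˡ (ℚᵘ.- ℚᵘ.mkℚᵘ (+ 1) 5) (toℚᵘ-/ i d)))))

∣6k-m∣ : ∀ k m e → k * 6 ≡ m + e → ℤ.∣ (+ k) ℤ.* (+ 6) ℤ.+ (ℤ.- (+ 1)) ℤ.* (+ m) ∣ ≡ e
∣6k-m∣ k m e k*6≡m+e = cong ℤ.∣_∣ (begin
  (+ k) ℤ.* (+ 6) ℤ.+ (ℤ.- (+ 1)) ℤ.* (+ m) ≡⟨ cong₂ ℤ._+_ (sym (ℤₚ.pos-* k 6)) (ℤₚ.-1*i≡-i (+ m)) ⟩
  + (k * 6) ℤ.+ ℤ.- (+ m)                   ≡⟨ ℤₚ.m-n≡m⊖n (k * 6) m ⟩
  (k * 6) ℤ.⊖ m                             ≡⟨ cong (ℤ._⊖ m) k*6≡m+e ⟩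
  (m + e) ℤ.⊖ m                             ≡⟨ cong ((m + e) ℤ.⊖_) (sym (ℕₚ.+-identityʳ m)) ⟩
  (m + e) ℤ.⊖ (m + 0)                       ≡⟨ ℤₚ.+-cancelˡ-⊖ m e 0 ⟩
  + e                                       ∎)
  where open ≡-Reasoning

distance-from-sixth : ∀ k m e p q .{{_ : NonZero m}} .{cop : Coprime (suc p) (suc q)}
                      → k * 6 ≡ m + e → e * suc q ℕ.< suc p * (m * 6)
                      → ∣ (+ k) / m - (+ 1) / 6 ∣ < mkℚ (+ suc p) q cop
distance-from-sixth k (suc d) e p q k*6≡m+e e*q<p*6m = ℚₚ.toℚᵘ-cancel-<
  (ℚᵘₚ.<-respˡ-≃ (ℚᵘₚ.≃-sym (toℚᵘ-∣/-1/6∣ (+ k) d)) (ℚᵘ.*<* numerators<))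
  where
    -- toℚᵘ (k / m − 1 / 6) is (6k − m) / 6m, so the claim is an inequality between numerators.
    numerators< : (+ ℤ.∣ (+ k) ℤ.* (+ 6) ℤ.+ (ℤ.- (+ 1)) ℤ.* (+ suc d) ∣) ℤ.* (+ suc q) ℤ.< (+ suc p) ℤ.* (+ (suc d * 6))
    numerators< rewrite ∣6k-m∣ k (suc d) e k*6≡m+e | sym (ℤₚ.pos-* e (suc q)) | sym (ℤₚ.pos-* (suc p) (suc d * 6))
      = +<+ e*q<p*6m

n<2^n : ∀ n → n ℕ.< 2 ^ n
n<2^n zero    = s≤s z≤n
n<2^n (suc n) = ℕₚ.+-mono-≤ (ℕₚ.m^n>0 2 n) (ℕₚ.≤-trans (n<2^n n) (ℕₚ.m≤m+n (2 ^ n) 0))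

excess≤16 : ∀ n → excess n ≤ 16
excess≤16 n with even? n
... | true  = ℕₚ.m≤m+n 8 8
... | false = ℕₚ.≤-refl

ratio-close : ∀ p q .{cop : Coprime (suc p) (suc q)} n → 16 * suc q + 2 ≤ n → ∣ ratio n - (+ 1) / 6 ∣ < mkℚ (+ suc p) q cop
ratio-close p q zero          N≤n with ℕₚ.≤-trans (ℕₚ.m≤n+m 2 (16 * suc q)) N≤n
... | ()
ratio-close p q (suc zero)    N≤n with ℕₚ.≤-trans (ℕₚ.m≤n+m 2 (16 * suc q)) N≤n
... | s≤s ()
ratio-close p q (suc (suc m)) N≤n =
  distance-from-sixth (K n) (2 ^ n) (excess m) p q {{ℕₚ.m^n≢0 2 n}} (trans (ℕₚ.*-comm (K n) 6) (K-closed-form m)) (begin-strict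
    excess m * suc q    ≤⟨ ℕₚ.*-monoˡ-≤ (suc q) (excess≤16 m) ⟩
    16 * suc q          <⟨ ℕₚ.m<m+n (16 * suc q) (s≤s z≤n) ⟩
    16 * suc q + 2      ≤⟨ N≤n ⟩
    n                   <⟨ n<2^n n ⟩
    2 ^ n               ≤⟨ ℕₚ.m≤m*n (2 ^ n) 6 ⟩
    2 ^ n * 6           ≤⟨ ℕₚ.m≤n*m (2 ^ n * 6) (suc p) ⟩
    suc p * (2 ^ n * 6) ∎)
  where
    open ℕₚ.≤-Reasoning
    n = suc (suc m)

corollary6p9 : (ε : ℚ) → 0ℚ < ε → ∃[ N ] ((n : ℕ) → N ≤ n → ∣ ratio n - (+ 1) / 6 ∣ < ε)
corollary6p9 (mkℚ (+ zero)  q _)   (*<* (+<+ ()))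
corollary6p9 (mkℚ -[1+ p ]  q _)   (*<* ())
corollary6p9 (mkℚ (+ suc p) q cop) _ = 16 * suc q + 2 , ratio-close p q
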